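{- Let $\mathcal{G}=\langle \mathit{Init},\mathit{Safe},\mathit{Reach},\mathit{Goal}\rangle$ be a reachability game, let $I=\mathit{Init}\land\neg\mathit{Goal}$, let $\varphi$ be a Craig interpolant for $I$ and $\mathit{Goal}$ (i.e., $\mathit{Goal}\Rightarrow\varphi$ valid, $I\land\varphi$ unsatisfiable, $\varphi$ over variables shared by $I$ and $\mathit{Goal}$), let $C=\operatorname{Instantiate}(\varphi,\mathcal{G})$, and let $$\mathcal{G}_{post}=\langle \operatorname{Post}(C)[\mathcal{V}'/\mathcal{V}],\ \mathit{Safe}\land\varphi,\ \mathit{Reach}\land\varphi,\ \mathit{Goal}\rangle.$$ If $\mathfrak{S}$ is a winning symbolic reachability strategy from a state $s$ in $\mathcal{G}_{post}$, then $\mathfrak{S}$ is also a winning symbolic reachability strategy from $s$ in $\mathcal{G}$.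
   Context: Fix a logic $\mathcal{L}$ and a finite set of variables $\mathcal{V}$ with domains, primed copies $\mathcal{V}'$, and a Boolean variable $\mathbf{r}\in\mathcal{V}$; $\varphi[\mathcal{V}/\mathcal{V}']$ primes all variables and $\varphi[\mathcal{V}'/\mathcal{V}]$ unprimes them. A state is a valuation of $\mathcal{V}$ respecting domains; $S_{\mathrm{REACH}}=\{s:s(\mathbf{r})=\mathrm{true}\}$, $S_{\mathrm{SAFE}}$ the other states; $\varphi(s)$, $\tau(s,s')$ denote evaluation of state/transition predicates, and $\tau(s)$ substitutes only unprimed variables. A reachability game $\langle \mathit{Init},\mathit{Safe},\mathit{Reach},\mathit{Goal}\rangle$ has state predicates $\mathit{Init},\mathit{Goal}$ and transition predicates $\mathit{Safe},\mathit{Reach}$ with $\mathit{Safe}\Rightarrow\neg\mathbf{r}$, $\mathit{Reach}\Rightarrow\mathbf{r}$ valid. A trap state is $s$ with $(\mathit{Safe}\lor\mathit{Reach})(s)$ unsatisfiable. A play from $s_0$ is a finite or infinite sequence $s_0s_1\ldots$ with $\mathit{Safe}(s_i,s_{i+1})$ or $\mathit{Reach}(s_i,s_{i+1})$ for consecutive pairs, ending in a trap state if finite. REACH wins a play if some state on it satisfies $\mathit{Goal}$. $\operatorname{Post}(T)=\exists\mathcal{V}.T$; $\operatorname{Instantiate}(\varphi,\mathcal{G})=(\mathit{Safe}\lor\mathit{Reach})\land\neg\varphi\land\varphi[\mathcal{V}/\mathcal{V}']$. A symbolic strategy for a game is a transition predicate $\mathfrak{S}$ with $\mathfrak{S}\Rightarrow(\mathit{Safe}\lor\mathit{Reach})$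 valid (for that game's $\mathit{Safe},\mathit{Reach}$). A play prefix is a finite prefix $s_0\ldots s_n$ of a play with $\neg\mathit{Goal}(s_j)$ for all $j\le n$ and $s_n$ not a trap. A prefix conforms to a symbolic reachability strategy $\mathfrak{S}$ if $\mathfrak{S}(s_j,s_{j+1})$ for all $j<n$ with $s_j\in S_{\mathrm{REACH}}$; a play conforms if all its play prefixes do. $\mathfrak{S}$ is winning for REACH in $s$ if every play from $s$ conforming to $\mathfrak{S}$ is won by REACH and every conforming play prefix from $s$ ending in $s_n\in S_{\mathrm{REACH}}$ has $(\mathfrak{S}\land\mathit{Reach})(s_n)$ satisfiable; all these notions are relative to the game under consideration. -}

module Defs where

open import Data.Nat using (ℕ; zero; suc; _≤_; _<_)
open import Data.Fin using (Fin)
open import Data.Bool using (Bool; true; false; T; _∧_; _∨_; not)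
open import Data.Product using (Σ; ∃; _×_; _,_)
open import Data.Empty using (⊥)
open import Relation.Nullary using (¬_)
open import Relation.Binary.PropositionalEquality using (_≡_; subst)
open import Function.Bundles using (_↔_; _⇔_)

-- Formulas of the logic ℒ are represented semantically
-- by their (two-valued) evaluation: a state predicate is a function
-- State → Bool, a transition predicate a function State → State → Bool
-- (first argument: valuation of 𝒱, second: valuation of 𝒱').

record Vocabulary : Set₁ where
  field
    Var     : Set
    finite  : Σ ℕ (λ n → Var ↔ Fin n)
    Dom     : Var → Set
    𝐫       : Var
    𝐫-Bool  : Dom 𝐫 ≡ Bool

  State : Set
  State = (v : Var) → Dom v

  field
    ∃𝒱[_][𝒱'/𝒱] : (State → State → Bool) → State → Bool
    ∃𝒱-sem : ∀ τ s' → T (∃𝒱[ τ ][𝒱'/𝒱] s') ⇔ (∃ λ s → T (τ s s'))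

module Sem (𝒱 : Vocabulary) where
  open Vocabulary 𝒱 public

  StatePred : Set
  StatePred = State → Bool

  TransPred : Set
  TransPred = State → State → Bool

  rval : State → Bool
  rval s = subst (λ X → X) 𝐫-Bool (s 𝐫)

  InReach : State → Set
  InReach s = T (rval s)

  VarSet : Set₁
  VarSet = Var → Set

  DependsOnly : StatePred → VarSet → Set
  DependsOnly φ W = ∀ s t → (∀ v → W v → s v ≡ t v) → φ s ≡ φ t

  record Game : Set where
    field
      Init  : StatePred
      Safe  : TransPred
      Reach : TransPred
      Goal  : StatePred
      safe-¬r : ∀ s s' → T (Safe s s') → ¬ InReach s
      reach-r : ∀ s s' → T (Reach s s') → InReach s

  module _ (G : Game) where
    open Game G

    Step : State → State → Set
    Step s s' = T (Safe s s' ∨ Reach s s')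

    Trap : State → Set
    Trap s = ¬ (∃ λ s' → Step s s')

    -- A play from s₀: a finite or infinite sequence.  It is given by
    -- seq : ℕ → State together with the set of defined positions
    -- (a down-closed set of indices containing 0, i.e. either all of ℕ
    -- or {0,…,n}); a finite play ends in a trap state.
    record Play (s₀ : State) : Set₁ where
      field
        Def       : ℕ → Set
        def-0     : Def 0
        def-down  : ∀ i → Def (suc i) → Def i
        seq       : ℕ → State
        start     : seq 0 ≡ s₀
        steps     : ∀ i → Def (suc i) → Step (seq i) (seq (suc i))
        ends      : ∀ i → Def i → ¬ Def (suc i) → Trap (seq i)

    WonByReach : ∀ {s₀} → Play s₀ → Set
    WonByReach p = ∃ λ i → Play.Def p i × T (Goal (Play.seq p i))

    IsPrefix : ∀ {s₀} → Play s₀ → ℕ → Set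
    IsPrefix p n = Play.Def p n
                 × (∀ j → j ≤ n → ¬ T (Goal (Play.seq p j)))
                 × ¬ Trap (Play.seq p n)

    IsStrategy : TransPred → Set
    IsStrategy 𝔖 = ∀ s s' → T (𝔖 s s') → Step s s'

    PrefixConforms : TransPred → ∀ {s₀} → Play s₀ → ℕ → Set
    PrefixConforms 𝔖 p n = ∀ j → j < n → InReach (Play.seq p j)
                         → T (𝔖 (Play.seq p j) (Play.seq p (suc j)))

    PlayConforms : TransPred → ∀ {s₀} → Play s₀ → Set
    PlayConforms 𝔖 p = ∀ n → IsPrefix p n → PrefixConforms 𝔖 p n

    Winning : TransPred → State → Set₁
    Winning 𝔖 s =
        (∀ (p : Play s) → PlayConforms 𝔖 p → WonByReach p)
      × (∀ (p : Play s) n → IsPrefix p n → PrefixConforms 𝔖 p n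
           → InReach (Play.seq p n)
           → ∃ λ s' → T (𝔖 (Play.seq p n) s' ∧ Reach (Play.seq p n) s'))

    I : StatePred
    I s = Init s ∧ not (Goal s)

    IsInterpolant : StatePred → Set₁
    IsInterpolant φ =
        (∀ s → T (Goal s) → T (φ s))
      × (∀ s → ¬ T (I s ∧ φ s))
      × (Σ VarSet λ W₁ → Σ VarSet λ W₂ →
            DependsOnly I W₁
          × DependsOnly Goal W₂
          × DependsOnly φ (λ v → W₁ v × W₂ v))

    Instantiate : StatePred → TransPred
    Instantiate φ s s' = (Safe s s' ∨ Reach s s') ∧ not (φ s) ∧ φ s'

    postGame : StatePred → Game
    postGame φ = record
      { Init    = ∃𝒱[ Instantiate φ ][𝒱'/𝒱]
      ; Safe    = λ s s' → Safe s s' ∧ φ s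
      ; Reach   = λ s s' → Reach s s' ∧ φ s
      ; Goal    = Goal
      ; safe-¬r = λ s s' h → safe-¬r s s' (∧-l h)
      ; reach-r = λ s s' h → reach-r s s' (∧-l h)
      }
      where
        ∧-l : ∀ {a b} → T (a ∧ b) → T a
        ∧-l {true} _ = _

-- A play of G is cut off at the first state violating φ; from there on the
-- post game has no moves, so the cut play is a play of the post game, and a
-- winning strategy there reaches Goal on it, hence on the original play.
-- The same cut shows that a conforming Goal-free prefix of a G-play stays
-- inside φ: otherwise the cut play would end before Goal is reached.
module Submission where

open import Defs
open import Data.Bool using (T; _∧_)
open import Data.Bool.Properties using (T-∧; ∧-distribʳ-∨)
open import Data.Empty using (⊥-elim)
open import Data.Nat using (ℕ; suc; _≤_; _<_; _≤?_)
open import Data.Nat.Properties using (≤-refl; ≤-trans; <⇒≤; ≰⇒>; n<1+n; m<n⇒m<1+n; m<1+n⇒m<n∨m≡n)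
open import Data.Product using (_×_; _,_; proj₁; proj₂; ∃)
open import Data.Sum using (inj₁; inj₂)
open import Function using (_∘_)
open import Function.Bundles using (_⇔_; mk⇔; Equivalence)
open import Relation.Nullary using (¬_; yes; no)
open import Relation.Nullary.Decidable using (T?)
open import Relation.Binary.PropositionalEquality using (refl; subst; sym)

∧-dropʳ : ∀ x y z → T (x ∧ (y ∧ z)) → T (x ∧ y)
∧-dropʳ x y z h with Equivalence.to (T-∧ {x}) h
... | tx , tyz = Equivalence.from T-∧ (tx , proj₁ (Equivalence.to (T-∧ {y} {z}) tyz))

module PostGame (𝒱 : Vocabulary) (G : Sem.Game 𝒱) (φ : Sem.StatePred 𝒱) where
  open Sem 𝒱
  open Game G

  post : Game
  post = postGame G φ

  step-post⇔ : ∀ a b → Step post a b ⇔ (Step G a b × T (φ a))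
  step-post⇔ a b = mk⇔
    (λ st → Equivalence.to T-∧ (subst T (sym distrib) st))
    (λ st → subst T distrib (Equivalence.from T-∧ st))
    where distrib = ∧-distribʳ-∨ (φ a) (Safe a b) (Reach a b)

  step-post⇒step : ∀ {a b} → Step post a b → Step G a b
  step-post⇒step = proj₁ ∘ Equivalence.to (step-post⇔ _ _)

  strategy-post⇒strategy : ∀ {𝔖} → IsStrategy post 𝔖 → IsStrategy G 𝔖
  strategy-post⇒strategy strat a b h = step-post⇒step (strat a b h)

  module _ {s : State} (p : Play G s) where
    open Play p

    φ-before : ℕ → Set
    φ-before i = ∀ j → j < i → T (φ (seq j))

    truncate : Play post s
    truncate = record
      { Def      = λ i → Def i × φ-before i
      ; def-0    = def-0 , λ _ ()
      ; def-down = λ i (d , f) → def-down i d , λ j j<i → f j (m<n⇒m<1+n j<i)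
      ; seq      = seq
      ; start    = start
      ; steps    = λ i (d , f) → Equivalence.from (step-post⇔ _ _)
                                   (steps i d , f i (n<1+n i))
      ; ends     = ends-truncated
      }
      where
        ends-truncated : ∀ i → Def i × φ-before i → ¬ (Def (suc i) × φ-before (suc i))
                       → Trap post (seq i)
        ends-truncated i (d , f) stop (s' , st) =
          ends i d (λ d' → stop (d' , f′)) (s' , proj₁ moved)
          where
            moved = Equivalence.to (step-post⇔ _ _) st
            f′ : φ-before (suc i)
            f′ j j<1+i with m<1+n⇒m<n∨m≡n j<1+i
            ... | inj₁ j<i  = f j j<i
            ... | inj₂ refl = proj₂ moved

    won-truncate⇒won : WonByReach post truncate → WonByReach G p
    won-truncate⇒won (i , (d , _) , goal) = i , d , goal

    prefix-truncate⇒prefix : ∀ {n} → IsPrefix post truncate n → IsPrefix G p n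
    prefix-truncate⇒prefix ((d , _) , goal-free , ¬trap) =
      d , goal-free , λ trap → ¬trap λ (s' , st) → trap (s' , step-post⇒step st)

    prefix⇒prefix-truncate : ∀ {n} → IsPrefix G p n → (∀ k → k ≤ n → T (φ (seq k)))
                           → IsPrefix post truncate n
    prefix⇒prefix-truncate {n} (d , goal-free , ¬trap) inside =
      (d , λ j j<n → inside j (<⇒≤ j<n)) , goal-free ,
      λ trap → ¬trap λ (s' , st) → trap (s' , Equivalence.from (step-post⇔ _ _) (st , inside n ≤-refl))

    truncate-ends-at-¬φ : ∀ {k i} → ¬ T (φ (seq k)) → Play.Def truncate i → i ≤ k
    truncate-ends-at-¬φ {k} {i} ¬φ (_ , f) with i ≤? k
    ... | yes i≤k = i≤k
    ... | no  i≰k = ⊥-elim (¬φ (f k (≰⇒> i≰k)))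

    truncate-conforms : ∀ 𝔖 {k n} → ¬ T (φ (seq k)) → k ≤ n → PrefixConforms G 𝔖 p n
                      → PlayConforms post 𝔖 truncate
    truncate-conforms _ ¬φ k≤n conf m (d , _) j j<m =
      conf j (≤-trans j<m (≤-trans (truncate-ends-at-¬φ ¬φ d) k≤n))

  module _ {𝔖 : TransPred} {s : State} (win : Winning post 𝔖 s) where

    conforming-plays-won : ∀ (p : Play G s) → PlayConforms G 𝔖 p → WonByReach G p
    conforming-plays-won p conf =
      won-truncate⇒won p (proj₁ win (truncate p) λ n pre → conf n (prefix-truncate⇒prefix p pre))

    conforming-prefix-inside-φ : ∀ (p : Play G s) {n} → IsPrefix G p n → PrefixConforms G 𝔖 p n
                               → ∀ k → k ≤ n → T (φ (Play.seq p k))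
    conforming-prefix-inside-φ p (_ , goal-free , _) conf k k≤n with T? (φ (Play.seq p k))
    ... | yes φk = φk
    ... | no ¬φk with proj₁ win (truncate p) (truncate-conforms p 𝔖 ¬φk k≤n conf)
    ...   | i , d , goal = ⊥-elim (goal-free i (≤-trans (truncate-ends-at-¬φ p ¬φk d) k≤n) goal)

    reach-moves-available :
      ∀ (p : Play G s) n → IsPrefix G p n → PrefixConforms G 𝔖 p n → InReach (Play.seq p n)
      → ∃ λ s' → T (𝔖 (Play.seq p n) s' ∧ Reach (Play.seq p n) s')
    reach-moves-available p n pre conf inR
      with proj₂ win (truncate p) n
             (prefix⇒prefix-truncate p pre (conforming-prefix-inside-φ p pre conf)) conf inR
    ... | s' , h = s' , ∧-dropʳ (𝔖 _ s') (Reach _ s') (φ _) h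

    winning-post⇒winning : Winning G 𝔖 s
    winning-post⇒winning = conforming-plays-won , reach-moves-available

lemma5 : (𝒱 : Vocabulary) → let open Sem 𝒱 in
    (G : Game) (φ : StatePred) (𝔖 : TransPred) (s : State) →
    IsInterpolant G φ →
    IsStrategy (postGame G φ) 𝔖 →
    Winning (postGame G φ) 𝔖 s →
    IsStrategy G 𝔖 × Winning G 𝔖 s
lemma5 𝒱 G φ 𝔖 s _ strat win = strategy-post⇒strategy strat , winning-post⇒winning {𝔖} win
  where open PostGame 𝒱 G φ
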